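{- Let $\mathbf{k}$ be a commutative ring, $q\in\mathbf{k}$, $s\ge 0$ and $I\subseteq[s-1]$. Then \[\eta^{(q)}_I=\sum_{I\subseteq J\subseteq[s-1]}(q+1)^{s-|J|}M_J.\]
   Context: Let $x_1,x_2,\dots$ be commuting indeterminates; $[s-1]=\{1,\dots,s-1\}$ (empty if $s\le1$). For $I\subseteq[s-1]$ define in $\mathbf{k}[[x_1,x_2,\dots]]$: $M_I=\sum x_{i_1}\cdots x_{i_s}$ over sequences of positive integers $i_1\le\cdots\le i_s$ such that for each $j\in[s-1]$, $j\in I\iff i_j=i_{j+1}$; and $\eta^{(q)}_I=\sum (q+1)^{|\{i_1,\dots,i_s\}|}x_{i_1}\cdots x_{i_s}$ over sequences $i_1\le\cdots\le i_s$ such that $j\in I\Rightarrow i_j=i_{j+1}$. -}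

module Defs where

open import Level using (Level)
open import Algebra.Bundles using (CommutativeRing)
open import Data.Bool using (Bool; true; false; if_then_else_; _∧_; _∨_; not)
open import Data.Nat using (ℕ; zero; suc; _≤_; _≡ᵇ_; _∸_)
import Data.Nat as N
open import Data.Nat.Properties using () renaming (_≟_ to _≟ℕ_)
open import Data.Fin using (Fin; toℕ)
open import Data.Fin.Subset using (Subset; _⊆_; ∣_∣; inside; outside)
open import Data.Fin.Subset.Properties using (_⊆?_)
open import Data.List using (List; []; _∷_; length; allFin; map; filter; deduplicate; foldr)
open import Data.List.Relation.Unary.Linked using (Linked)
open import Data.Vec using (Vec; []; _∷_; lookup)

-- Monomials in x_1, x_2, ... are represented canonically as weakly
-- increasing lists [i_1, ..., i_s] of indices (the monomial x_{i_1}...x_{i_s}).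
-- Index n : ℕ stands for the variable x_{n+1} (so all positive integers are covered).
Monomial : List ℕ → Set
Monomial w = Linked _≤_ w

module Series {c ℓ : Level} (R : CommutativeRing c ℓ) where
  open CommutativeRing R

  -- A formal power series: its coefficient function on monomials
  -- (values on non-sorted lists are irrelevant).
  PowerSeries : Set c
  PowerSeries = List ℕ → Carrier

  _≋_ : PowerSeries → PowerSeries → Set (ℓ Level.⊔ Level.zero)
  f ≋ g = (w : List ℕ) → Monomial w → f w ≈ g w

  _⊕_ : PowerSeries → PowerSeries → PowerSeries
  (f ⊕ g) w = f w + g w

  _·_ : Carrier → PowerSeries → PowerSeries
  (a · f) w = a * f w

  zeroS : PowerSeries
  zeroS w = 0#

  sumS : List PowerSeries → PowerSeries
  sumS = foldr _⊕_ zeroS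

  pow : Carrier → ℕ → Carrier
  pow x zero = 1#
  pow x (suc n) = x * pow x n

  -- The series  Σ_{i_1 ≤ ... ≤ i_s, P(i)} f(i) x_{i_1} ... x_{i_s}.
  -- Each monomial arises from exactly one weakly increasing sequence
  -- (namely its sorted index list), so its coefficient is f(w) if
  -- length w = s and P(w), and 0 otherwise.
  sortedSum : ℕ → (List ℕ → Bool) → (List ℕ → Carrier) → PowerSeries
  sortedSum s P f w = if (length w ≡ᵇ s) ∧ P w then f w else 0#

-- adjEq w j : i_{j+1} = i_{j+2} (0-based j), i.e. for the 1-based
-- position p = j+1 ∈ [s-1], whether i_p = i_{p+1}.
adjEq : List ℕ → ℕ → Bool
adjEq (a ∷ b ∷ w) zero = a ≡ᵇ b
adjEq (a ∷ w) (suc j) = adjEq w j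
adjEq _ _ = false

allB : {A : Set} → (A → Bool) → List A → Bool
allB p [] = true
allB p (x ∷ xs) = p x ∧ allB p xs

-- Subsets of [s-1] are Subset (s ∸ 1); position j : Fin (s ∸ 1) stands for j+1 ∈ [s-1].
_⇔ᵇ_ : Bool → Bool → Bool
a ⇔ᵇ b = if a then b else not b

exactPattern : ∀ {m} → Subset m → List ℕ → Bool
exactPattern {m} I w = allB (λ j → lookup I j ⇔ᵇ adjEq w (toℕ j)) (allFin m)

coarserPattern : ∀ {m} → Subset m → List ℕ → Bool
coarserPattern {m} I w = allB (λ j → not (lookup I j) ∨ adjEq w (toℕ j)) (allFin m)

numDistinct : List ℕ → ℕ
numDistinct w = length (deduplicate _≟ℕ_ w)

allSubsets : (m : ℕ) → List (Subset m)
allSubsets zero = [] ∷ []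
allSubsets (suc m) = map (inside ∷_) (allSubsets m) Data.List.++ map (outside ∷_) (allSubsets m)

module QSym {c ℓ : Level} (R : CommutativeRing c ℓ) where
  open CommutativeRing R
  open Series R public

  M : (s : ℕ) → Subset (s ∸ 1) → PowerSeries
  M s I = sortedSum s (exactPattern I) (λ _ → 1#)

  η : (q : Carrier) → (s : ℕ) → Subset (s ∸ 1) → PowerSeries
  η q s I = sortedSum s (coarserPattern I) (λ w → pow (q + 1#) (numDistinct w))

  rhs : (q : Carrier) → (s : ℕ) → Subset (s ∸ 1) → PowerSeries
  rhs q s I = sumS (map (λ J → pow (q + 1#) (s ∸ ∣ J ∣) · M s J)
                        (filter (λ J → I ⊆? J) (allSubsets (s ∸ 1))))

{-# OPTIONS --safe #-}
module Submission where

-- A weakly increasing index list w of length s has an adjacency pattern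
-- P(w) ⊆ [s-1], the positions j with i_j = i_{j+1}.  The coefficient of
-- x_w in M_J is 1 if J = P(w) and 0 otherwise, and its coefficient in η_I
-- is (q+1)^{#distinct entries of w} if I ⊆ P(w) and 0 otherwise.  Equal
-- entries of a sorted list are adjacent, so w has exactly s - |P(w)|
-- distinct entries, and the right-hand side collapses to its single term
-- J = P(w).

open import Defs
open import Level using (Level)
open import Algebra.Bundles using (CommutativeRing)
open import Data.Bool using (Bool; true; false; if_then_else_; _∧_; _∨_; not; T)
open import Data.Bool.Properties using (T-≡; if-cong; if-eta) renaming (_≟_ to _≟ᵇ_)
open import Data.Fin using (Fin; toℕ)
open import Data.Fin.Subset using (Subset; _⊆_; _∈_; ∣_∣; inside; outside)
open import Data.Fin.Subset.Properties using (_⊆?_)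
open import Data.Bool.ListAction using (all)
open import Data.List using (List; []; _∷_; length; allFin; map; filter; deduplicate; _++_)
open import Data.List.Properties using (filter-all; filter-reject; filter-idem)
open import Data.List.Relation.Unary.All as All using (All)
open import Data.List.Relation.Unary.All.Properties using (all⁺; all⁻; tabulate⁺; tabulate⁻; deduplicate⁺)
open import Data.List.Relation.Unary.Linked using (_∷_)
open import Data.List.Relation.Unary.Linked.Properties using (Linked⇒All)
import Data.Nat as ℕ
open import Data.Nat using (ℕ; zero; suc; _∸_; _≤_; _<_; _≡ᵇ_)
open import Data.Nat.Properties using (_≟_; ≤-refl; ≤-trans; <-≤-trans; <⇒≢; ≤∧≢⇒<; +-suc; m+n∸n≡m; ≡⇒≡ᵇ; ≡ᵇ⇒≡)
open import Data.Unit using (tt)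
open import Data.Vec using ([]; _∷_; lookup; tabulate; tail)
open import Data.Vec.Properties using (≡-dec; lookup∘tabulate; tabulate∘lookup; tabulate-cong; []=⇒lookup; lookup⇒[]=)
open import Function using (_∘_; _⇔_; mk⇔; Equivalence)
open import Relation.Binary.Definitions using (DecidableEquality)
open import Relation.Binary.PropositionalEquality
  using (_≡_; _≢_; refl; sym; trans; cong; cong₂; subst; module ≡-Reasoning)
open import Relation.Nullary using (Dec; yes; no; does; ¬?)
open import Relation.Nullary.Decidable using (T?; does-⇔; dec-true; dec-false)
open import Relation.Nullary.Negation using (contradiction)

open Equivalence using (to; from)

adjacencyPattern : (w : List ℕ) → Subset (length w ∸ 1)
adjacencyPattern w = tabulate (λ j → adjEq w (toℕ j))

lookup-adjacencyPattern : (w : List ℕ) (j : Fin (length w ∸ 1)) →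
                          lookup (adjacencyPattern w) j ≡ adjEq w (toℕ j)
lookup-adjacencyPattern w = lookup∘tabulate _

_≟ₛ_ : ∀ {m} → DecidableEquality (Subset m)
_≟ₛ_ = ≡-dec _≟ᵇ_

∈⇔T-lookup : ∀ {m} {j : Fin m} {p : Subset m} → j ∈ p ⇔ T (lookup p j)
∈⇔T-lookup {j = j} {p} = mk⇔ (from T-≡ ∘ []=⇒lookup) (lookup⇒[]= j p ∘ to T-≡)

T-⇔ᵇ : ∀ {a b} → T (a ⇔ᵇ b) ⇔ a ≡ b
T-⇔ᵇ {true}  {true}  = mk⇔ (λ _ → refl) (λ _ → tt)
T-⇔ᵇ {true}  {false} = mk⇔ (λ ()) (λ ())
T-⇔ᵇ {false} {true}  = mk⇔ (λ ()) (λ ())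
T-⇔ᵇ {false} {false} = mk⇔ (λ _ → refl) (λ _ → tt)

T-not-∨ : ∀ {a b} → T (not a ∨ b) ⇔ (T a → T b)
T-not-∨ {true}  {true}  = mk⇔ (λ _ _ → tt) (λ _ → tt)
T-not-∨ {true}  {false} = mk⇔ (λ ()) (λ f → f tt)
T-not-∨ {false}         = mk⇔ (λ _ ()) (λ _ → tt)

allB≡all : {A : Set} (p : A → Bool) (xs : List A) → allB p xs ≡ all p xs
allB≡all p []       = refl
allB≡all p (x ∷ xs) = cong (p x ∧_) (allB≡all p xs)

T-allB-allFin : ∀ {m} (p : Fin m → Bool) → T (allB p (allFin m)) ⇔ (∀ j → T (p j))
T-allB-allFin {m} p = mk⇔
  (λ h → tabulate⁻ (all⁺ p (allFin m) (subst T (allB≡all p (allFin m)) h)))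
  (λ h → subst T (sym (allB≡all p (allFin m))) (all⁻ p (tabulate⁺ h)))

T-exactPattern : (w : List ℕ) (J : Subset (length w ∸ 1)) →
                 T (exactPattern J w) ⇔ J ≡ adjacencyPattern w
T-exactPattern w J = mk⇔ agrees⇒≡ (λ { refl → from allFin-agrees (from T-⇔ᵇ ∘ lookup-adjacencyPattern w) })
  where
  allFin-agrees = T-allB-allFin (λ j → lookup J j ⇔ᵇ adjEq w (toℕ j))
  agrees⇒≡ : T (exactPattern J w) → J ≡ adjacencyPattern w
  agrees⇒≡ h = trans (sym (tabulate∘lookup J)) (tabulate-cong (to T-⇔ᵇ ∘ to allFin-agrees h))

T-coarserPattern : (w : List ℕ) (I : Subset (length w ∸ 1)) →
                   T (coarserPattern I w) ⇔ I ⊆ adjacencyPattern w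
T-coarserPattern w I = mk⇔
  (λ h {j} j∈I → from ∈⇔T-lookup (adj⇒pattern j (to T-not-∨ (to allFin-implies h j) (to ∈⇔T-lookup j∈I))))
  (λ I⊆P → from allFin-implies (λ j → from T-not-∨ (pattern⇒adj j ∘ to ∈⇔T-lookup ∘ I⊆P ∘ from ∈⇔T-lookup)))
  where
  allFin-implies = T-allB-allFin (λ j → not (lookup I j) ∨ adjEq w (toℕ j))
  adj⇒pattern : ∀ j → T (adjEq w (toℕ j)) → T (lookup (adjacencyPattern w) j)
  adj⇒pattern j = subst T (sym (lookup-adjacencyPattern w j))
  pattern⇒adj : ∀ j → T (lookup (adjacencyPattern w) j) → T (adjEq w (toℕ j))
  pattern⇒adj j = subst T (lookup-adjacencyPattern w j)

exactPattern≡does : (w : List ℕ) (J : Subset (length w ∸ 1)) →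
                    exactPattern J w ≡ does (J ≟ₛ adjacencyPattern w)
exactPattern≡does w J = does-⇔ (T-exactPattern w J) (T? _) (J ≟ₛ _)

coarserPattern≡does : (w : List ℕ) (I : Subset (length w ∸ 1)) →
                      coarserPattern I w ≡ does (I ⊆? adjacencyPattern w)
coarserPattern≡does w I = does-⇔ (T-coarserPattern w I) (T? _) (I ⊆? _)

module _ {A : Set} (_≟ᴬ_ : DecidableEquality A) where

  deduplicate-repeat : ∀ x xs → deduplicate _≟ᴬ_ (x ∷ x ∷ xs) ≡ deduplicate _≟ᴬ_ (x ∷ xs)
  deduplicate-repeat x xs = cong (x ∷_) (begin
      filter x≢? (x ∷ filter x≢? (deduplicate _≟ᴬ_ xs)) ≡⟨ filter-reject x≢? (λ x≢x → x≢x refl) ⟩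
      filter x≢? (filter x≢? (deduplicate _≟ᴬ_ xs))     ≡⟨ filter-idem x≢? (deduplicate _≟ᴬ_ xs) ⟩
      filter x≢? (deduplicate _≟ᴬ_ xs)                   ∎)
    where
    open ≡-Reasoning
    x≢? = ¬? ∘ (x ≟ᴬ_)

  deduplicate-fresh : ∀ {x xs} → All (x ≢_) xs → deduplicate _≟ᴬ_ (x ∷ xs) ≡ x ∷ deduplicate _≟ᴬ_ xs
  deduplicate-fresh {x} x∉xs = cong (x ∷_) (filter-all (¬? ∘ (x ≟ᴬ_)) (deduplicate⁺ _≟ᴬ_ x∉xs))

sorted-fresh : ∀ {b c ys} → b < c → Monomial (c ∷ ys) → All (b ≢_) (c ∷ ys)
sorted-fresh b<c sorted = All.map (λ c≤y → <⇒≢ (<-≤-trans b<c c≤y)) (Linked⇒All ≤-trans ≤-refl sorted)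

numDistinct+∣adjacencyPattern∣ : ∀ w → Monomial w → numDistinct w ℕ.+ ∣ adjacencyPattern w ∣ ≡ length w
numDistinct+∣adjacencyPattern∣ []       _ = refl
numDistinct+∣adjacencyPattern∣ (_ ∷ []) _ = refl
numDistinct+∣adjacencyPattern∣ (b ∷ c ∷ ys) (b≤c ∷ sorted) =
  prepend b≤c sorted (numDistinct+∣adjacencyPattern∣ (c ∷ ys) sorted) (b ≟ c)
  where
  open ≡-Reasoning
  -- The head of adjacencyPattern (b ∷ c ∷ ys) is definitionally does (b ≟ c);
  -- abstracting the decision lets the two cases compute it.
  prepend : ∀ {b c} → b ≤ c → Monomial (c ∷ ys) →
         numDistinct (c ∷ ys) ℕ.+ ∣ adjacencyPattern (c ∷ ys) ∣ ≡ length (c ∷ ys) →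
         (b≟c : Dec (b ≡ c)) →
         numDistinct (b ∷ c ∷ ys) ℕ.+ ∣ does b≟c ∷ adjacencyPattern (c ∷ ys) ∣ ≡ length (b ∷ c ∷ ys)
  prepend {b} _ _ ih (yes refl) = begin
    numDistinct (b ∷ b ∷ ys) ℕ.+ suc ∣ adjacencyPattern (b ∷ ys) ∣
      ≡⟨ cong (λ d → length d ℕ.+ suc ∣ adjacencyPattern (b ∷ ys) ∣) (deduplicate-repeat _≟_ b ys) ⟩
    numDistinct (b ∷ ys) ℕ.+ suc ∣ adjacencyPattern (b ∷ ys) ∣
      ≡⟨ +-suc (numDistinct (b ∷ ys)) ∣ adjacencyPattern (b ∷ ys) ∣ ⟩
    suc (numDistinct (b ∷ ys) ℕ.+ ∣ adjacencyPattern (b ∷ ys) ∣)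
      ≡⟨ cong suc ih ⟩
    length (b ∷ b ∷ ys) ∎
  prepend {b} {c} b≤c sorted ih (no b≢c) = begin
    numDistinct (b ∷ c ∷ ys) ℕ.+ ∣ adjacencyPattern (c ∷ ys) ∣
      ≡⟨ cong (λ d → length d ℕ.+ ∣ adjacencyPattern (c ∷ ys) ∣)
              (deduplicate-fresh _≟_ (sorted-fresh (≤∧≢⇒< b≤c b≢c) sorted)) ⟩
    suc (numDistinct (c ∷ ys) ℕ.+ ∣ adjacencyPattern (c ∷ ys) ∣)
      ≡⟨ cong suc ih ⟩
    length (b ∷ c ∷ ys) ∎

numDistinct≡length∸∣adjacencyPattern∣ : ∀ w → Monomial w → numDistinct w ≡ length w ∸ ∣ adjacencyPattern w ∣
numDistinct≡length∸∣adjacencyPattern∣ w sorted = begin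
  numDistinct w                      ≡⟨ m+n∸n≡m (numDistinct w) ∣ P ∣ ⟨
  numDistinct w ℕ.+ ∣ P ∣ ∸ ∣ P ∣    ≡⟨ cong (_∸ ∣ P ∣) (numDistinct+∣adjacencyPattern∣ w sorted) ⟩
  length w ∸ ∣ P ∣                   ∎
  where
  open ≡-Reasoning
  P = adjacencyPattern w

module Coefficients {c ℓ : Level} (R : CommutativeRing c ℓ) where
  open CommutativeRing R renaming (refl to ≈-refl; sym to ≈-sym; trans to ≈-trans)
  open QSym R
  open import Relation.Binary.Reasoning.Setoid setoid

  ∑ : {A : Set} → List A → (A → Carrier) → Carrier
  ∑ []       f = 0#
  ∑ (x ∷ xs) f = f x + ∑ xs f

  ∑-zeros : {A : Set} (xs : List A) (f : A → Carrier) → (∀ x → f x ≈ 0#) → ∑ xs f ≈ 0#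
  ∑-zeros []       f f≈0 = ≈-refl
  ∑-zeros (x ∷ xs) f f≈0 = ≈-trans (+-cong (f≈0 x) (∑-zeros xs f f≈0)) (+-identityˡ 0#)

  ∑-++ : {A : Set} (xs ys : List A) (f : A → Carrier) → ∑ (xs ++ ys) f ≈ ∑ xs f + ∑ ys f
  ∑-++ []       ys f = ≈-sym (+-identityˡ (∑ ys f))
  ∑-++ (x ∷ xs) ys f = ≈-trans (+-congˡ (∑-++ xs ys f)) (≈-sym (+-assoc (f x) (∑ xs f) (∑ ys f)))

  ∑-map : {A B : Set} (g : A → B) (xs : List A) (f : B → Carrier) → ∑ (map g xs) f ≡ ∑ xs (f ∘ g)
  ∑-map g []       f = refl
  ∑-map g (x ∷ xs) f = cong (f (g x) +_) (∑-map g xs f)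

  ∑-filter : {A : Set} {P : A → Set} (P? : ∀ x → Dec (P x)) (xs : List A) (f : A → Carrier) →
             ∑ (filter P? xs) f ≈ ∑ xs (λ x → if does (P? x) then f x else 0#)
  ∑-filter P? []       f = ≈-refl
  ∑-filter P? (x ∷ xs) f with does (P? x)
  ... | true  = +-congˡ (∑-filter P? xs f)
  ... | false = ≈-trans (∑-filter P? xs f) (≈-sym (+-identityˡ _))

  ∑-allSubsets-suc : ∀ m (f : Subset (suc m) → Carrier) →
                     ∑ (allSubsets (suc m)) f ≈ ∑ (allSubsets m) (f ∘ (inside ∷_)) + ∑ (allSubsets m) (f ∘ (outside ∷_))
  ∑-allSubsets-suc m f = begin
    ∑ (map (inside ∷_) A ++ map (outside ∷_) A) f        ≈⟨ ∑-++ (map (inside ∷_) A) (map (outside ∷_) A) f ⟩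
    ∑ (map (inside ∷_) A) f + ∑ (map (outside ∷_) A) f ≡⟨ cong₂ _+_ (∑-map (inside ∷_) A f) (∑-map (outside ∷_) A f) ⟩
    ∑ A (f ∘ (inside ∷_)) + ∑ A (f ∘ (outside ∷_))      ∎
    where A = allSubsets m

  ∑-allSubsets-single : ∀ m (p : Subset m) (f : Subset m → Carrier) →
                        (∀ q → q ≢ p → f q ≈ 0#) → ∑ (allSubsets m) f ≈ f p
  ∑-allSubsets-single zero [] f _ = +-identityʳ (f [])
  ∑-allSubsets-single (suc m) (inside ∷ p) f f≈0 = begin
    ∑ (allSubsets (suc m)) f                       ≈⟨ ∑-allSubsets-suc m f ⟩
    ∑ A (f ∘ (inside ∷_)) + ∑ A (f ∘ (outside ∷_)) ≈⟨ +-cong (∑-allSubsets-single m p _ (λ q q≢p → f≈0 _ (q≢p ∘ cong tail)))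
                                                              (∑-zeros A _ (λ q → f≈0 _ λ ())) ⟩
    f (inside ∷ p) + 0#                            ≈⟨ +-identityʳ _ ⟩
    f (inside ∷ p)                                 ∎
    where A = allSubsets m
  ∑-allSubsets-single (suc m) (outside ∷ p) f f≈0 = begin
    ∑ (allSubsets (suc m)) f                       ≈⟨ ∑-allSubsets-suc m f ⟩
    ∑ A (f ∘ (inside ∷_)) + ∑ A (f ∘ (outside ∷_)) ≈⟨ +-cong (∑-zeros A _ (λ q → f≈0 _ λ ()))
                                                              (∑-allSubsets-single m p _ (λ q q≢p → f≈0 _ (q≢p ∘ cong tail))) ⟩
    0# + f (outside ∷ p)                           ≈⟨ +-identityˡ _ ⟩
    f (outside ∷ p)                                ∎
    where A = allSubsets m

  if-then-cong : ∀ b {x y z} → x ≈ y → (if b then x else z) ≈ (if b then y else z)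
  if-then-cong true  x≈y = x≈y
  if-then-cong false _   = ≈-refl

  sumS-map-at : {A : Set} (g : A → PowerSeries) (xs : List A) (w : List ℕ) →
                sumS (map g xs) w ≡ ∑ xs (λ x → g x w)
  sumS-map-at g []       w = refl
  sumS-map-at g (x ∷ xs) w = cong (g x w +_) (sumS-map-at g xs w)

  sortedSum-length : ∀ s P f w → length w ≡ s → sortedSum s P f w ≡ (if P w then f w else 0#)
  sortedSum-length s P f w ∣w∣≡s with length w ≡ᵇ s | ≡⇒≡ᵇ (length w) s ∣w∣≡s
  ... | true | _ = refl

  sortedSum-≢ : ∀ s P f w → length w ≢ s → sortedSum s P f w ≡ 0#
  sortedSum-≢ s P f w ∣w∣≢s with length w ≡ᵇ s | ≡ᵇ⇒≡ (length w) s
  ... | true  | ∣w∣≡s = contradiction (∣w∣≡s tt) ∣w∣≢s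
  ... | false | _     = refl

  M-coefficient : ∀ w (J : Subset (length w ∸ 1)) →
                  M (length w) J w ≡ (if does (J ≟ₛ adjacencyPattern w) then 1# else 0#)
  M-coefficient w J =
    trans (sortedSum-length (length w) (exactPattern J) (λ _ → 1#) w refl) (if-cong (exactPattern≡does w J))

  M-adjacencyPattern : ∀ w → M (length w) (adjacencyPattern w) w ≡ 1#
  M-adjacencyPattern w = trans (M-coefficient w P) (if-cong (dec-true (P ≟ₛ P) refl))
    where P = adjacencyPattern w

  M-≢adjacencyPattern : ∀ w (J : Subset (length w ∸ 1)) → J ≢ adjacencyPattern w → M (length w) J w ≡ 0#
  M-≢adjacencyPattern w J J≢P = trans (M-coefficient w J) (if-cong (dec-false (J ≟ₛ adjacencyPattern w) J≢P))

  patternCoefficient : Carrier → (w : List ℕ) → Subset (length w ∸ 1) → Carrier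
  patternCoefficient q w I =
    if does (I ⊆? adjacencyPattern w) then pow (q + 1#) (length w ∸ ∣ adjacencyPattern w ∣) else 0#

  rhsTerm : Carrier → (s : ℕ) → Subset (s ∸ 1) → PowerSeries
  rhsTerm q s J = pow (q + 1#) (s ∸ ∣ J ∣) · M s J

  η-coefficient : ∀ q w (I : Subset (length w ∸ 1)) → Monomial w →
                  η q (length w) I w ≡ patternCoefficient q w I
  η-coefficient q w I sorted =
    trans (sortedSum-length (length w) (coarserPattern I) (pow (q + 1#) ∘ numDistinct) w refl)
      (cong₂ (λ b n → if b then pow (q + 1#) n else 0#)
             (coarserPattern≡does w I) (numDistinct≡length∸∣adjacencyPattern∣ w sorted))

  rhs-coefficient : ∀ q w (I : Subset (length w ∸ 1)) →
                    rhs q (length w) I w ≈ patternCoefficient q w I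
  rhs-coefficient q w I = begin
    rhs q s I w                                ≡⟨ sumS-map-at (rhsTerm q s) (filter (I ⊆?_) Js) w ⟩
    ∑ (filter (I ⊆?_) Js) (λ J → rhsTerm q s J w) ≈⟨ ∑-filter (I ⊆?_) Js (λ J → rhsTerm q s J w) ⟩
    ∑ Js selected                              ≈⟨ ∑-allSubsets-single (s ∸ 1) P selected selected-≢ ⟩
    selected P                                 ≈⟨ if-then-cong (does (I ⊆? P)) weight ⟩
    patternCoefficient q w I                   ∎
    where
    s = length w
    P = adjacencyPattern w
    Js = allSubsets (s ∸ 1)
    selected : Subset (s ∸ 1) → Carrier
    selected J = if does (I ⊆? J) then rhsTerm q s J w else 0#
    selected-≢ : ∀ J → J ≢ P → selected J ≈ 0#
    selected-≢ J J≢P = ≈-trans (if-then-cong (does (I ⊆? J))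
                                  (≈-trans (*-congˡ (reflexive (M-≢adjacencyPattern w J J≢P))) (zeroʳ _)))
                               (reflexive (if-eta _))
    weight : rhsTerm q s P w ≈ pow (q + 1#) (s ∸ ∣ P ∣)
    weight = ≈-trans (*-congˡ (reflexive (M-adjacencyPattern w))) (*-identityʳ _)

  η-≢ : ∀ q s (I : Subset (s ∸ 1)) w → length w ≢ s → η q s I w ≡ 0#
  η-≢ q s I w = sortedSum-≢ s (coarserPattern I) (pow (q + 1#) ∘ numDistinct) w

  rhs-≢ : ∀ q s (I : Subset (s ∸ 1)) w → length w ≢ s → rhs q s I w ≈ 0#
  rhs-≢ q s I w ∣w∣≢s = ≈-trans (reflexive (sumS-map-at (rhsTerm q s) Js w))
    (∑-zeros Js (λ J → rhsTerm q s J w) (λ J → ≈-trans (*-congˡ (reflexive (M-≢ J))) (zeroʳ _)))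
    where
    Js = filter (I ⊆?_) (allSubsets (s ∸ 1))
    M-≢ : ∀ J → M s J w ≡ 0#
    M-≢ J = sortedSum-≢ s (exactPattern J) (λ _ → 1#) w ∣w∣≢s

  η≋rhs : ∀ q s (I : Subset (s ∸ 1)) → η q s I ≋ rhs q s I
  η≋rhs q s I w sorted with length w ≟ s
  ... | yes refl = begin
    η q (length w) I w       ≡⟨ η-coefficient q w I sorted ⟩
    patternCoefficient q w I ≈⟨ rhs-coefficient q w I ⟨
    rhs q (length w) I w     ∎
  ... | no ∣w∣≢s = begin
    η q s I w   ≡⟨ η-≢ q s I w ∣w∣≢s ⟩
    0#          ≈⟨ rhs-≢ q s I w ∣w∣≢s ⟨
    rhs q s I w ∎

proposition3p6 : {c ℓ : Level} (R : CommutativeRing c ℓ) (q : CommutativeRing.Carrier R) (s : ℕ) (I : Subset (s ∸ 1)) → QSym._≋_ R (QSym.η R q s I) (QSym.rhs R q s I)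
proposition3p6 R = Coefficients.η≋rhs R
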